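{- Let $v$ be a signed-simplicial vertex of a signed graph $G$. Then every positive or negative edge incident to $v$ is divisional; in particular $v$ and all its neighbors are divisional vertices.
   Context: A signed graph $G=(G^+,G^-,L_G)$ consists of simple graphs $G^+=(V_G,E_G^+)$, $G^-=(V_G,E_G^-)$ on a common finite vertex set and a loop set $L_G\subseteq V_G$. A vertex $v$ is signed simplicial if: (a) $\{u_1,v\},\{u_2,v\}\in E_G^+$ or both in $E_G^-$ (with $u_1\ne u_2$) implies $\{u_1,u_2\}\in E_G^+$; (b) $\{u_1,v\}\in E_G^+$, $\{u_2,v\}\in E_G^-$ (with $u_1\ne u_2$) implies $\{u_1,u_2\}\in E_G^-$; (c) if $\{u,v\}\in E_G^+\cup E_G^-$ and $v\in L_G$, or $\{u,v\}\in E_G^+\cap E_G^-$, then $u\in L_G$. Contraction of a positive edge $\{v,w\}$: $G/(v,w)$ has vertex set $V_G\setminus\{v\}$; positive edges those not containing $v$ plus $\{u,w\}$ for $u\ne w$ with $\{u,v\}\in E_G^+$; negative edges those not containing $v$ plus $\{u,w\}$ for $u\ne w$ with $\{u,v\}\in E_G^-$; loops $L_G\setminus\{v\}$ plus $w$ if $v\in L_G$ or $\{v,w\}\in E_G^-$. For a negative edge the new edges $\{u,w\}$ are positive when $\{u,v\}\in E_G^-$ and negative when $\{u,v\}\in E_G^+$, and $w$ gets a loop if $v\in L_G$ or $\{v,w\}\in E_G^+$. With $\Lambda_k=\{0,\pm1,\dots,\pm k\}$, a proper $k$-coloring is $\gamma:V_G\to\Lambda_k$ with $\gamma(u)\ne\gamma(v)$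 on positive edges, $\gamma(u)\ne-\gamma(v)$ on negative edges, $\gamma(v)\ne0$ on loops; $\chi(G,t)$ is the polynomial with $\chi(G,2k+1)=$ number of proper $k$-colorings for all $k\ge1$. An edge $\{v,w\}$ is divisional if $\chi(G/(v,w),t)$ divides $\chi(G,t)$; its endvertices are then called divisional vertices. -}

module Defs where

open import Data.Bool using (Bool; true; false; _∧_; _∨_; not)
open import Data.Nat using (ℕ; zero; suc; _≤_)
open import Data.Fin using (Fin; punchIn)
open import Data.Fin.Properties renaming (_≟_ to _≟ᶠ_)
open import Data.Integer using (ℤ; +_; -_; _-_) renaming (_+_ to _+ℤ_; _*_ to _*ℤ_)
import Data.Integer.Properties as ℤP
open import Data.List using (List; []; _∷_; map; concatMap; allFin; filterᵇ; length; foldr)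
open import Data.Vec using (Vec; lookup) renaming ([] to []ᵥ; _∷_ to _∷ᵥ_)
open import Data.Product using (Σ; _×_)
open import Relation.Nullary using (¬_)
open import Relation.Nullary.Decidable using (⌊_⌋)
open import Relation.Binary.PropositionalEquality using (_≡_; _≢_)

record SGraph (n : ℕ) : Set where
  field
    pos  : Fin n → Fin n → Bool
    neg  : Fin n → Fin n → Bool
    loop : Fin n → Bool
open SGraph public

record WellFormed {n : ℕ} (G : SGraph n) : Set where
  field
    pos-sym   : ∀ u v → pos G u v ≡ pos G v u
    neg-sym   : ∀ u v → neg G u v ≡ neg G v u
    pos-irr   : ∀ u → pos G u u ≡ false
    neg-irr   : ∀ u → neg G u u ≡ false

record SignedSimplicial {n : ℕ} (G : SGraph n) (v : Fin n) : Set where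
  field
    condA⁺ : ∀ u₁ u₂ → u₁ ≢ u₂ → pos G u₁ v ≡ true → pos G u₂ v ≡ true → pos G u₁ u₂ ≡ true
    condA⁻ : ∀ u₁ u₂ → u₁ ≢ u₂ → neg G u₁ v ≡ true → neg G u₂ v ≡ true → pos G u₁ u₂ ≡ true
    condB  : ∀ u₁ u₂ → u₁ ≢ u₂ → pos G u₁ v ≡ true → neg G u₂ v ≡ true → neg G u₁ u₂ ≡ true
    condC₁ : ∀ u → (pos G u v ∨ neg G u v) ≡ true → loop G v ≡ true → loop G u ≡ true
    condC₂ : ∀ u → pos G u v ≡ true → neg G u v ≡ true → loop G u ≡ true

data Sign : Set where
  plus minus : Sign

infix 4 _==_
_==_ : {n : ℕ} → Fin n → Fin n → Bool
a == b = ⌊ a ≟ᶠ b ⌋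

bySign : {A : Set} → Sign → A → A → A
bySign plus  a b = a
bySign minus a b = b

-- Contraction G/(v,w) of the edge {v,w} regarded as an edge of sign s.
-- The new vertex set V∖{v} is Fin n, embedded into Fin (suc n) by punchIn v.
contract : {n : ℕ} → SGraph (suc n) → Sign → (v w : Fin (suc n)) → SGraph n
contract {n} G s v w = record { pos = P ; neg = N ; loop = L }
  where
    ι : Fin n → Fin (suc n)
    ι = punchIn v
    -- edges u–v of G that become positive / negative edges u–w
    toPos : Fin (suc n) → Bool
    toPos u = bySign s (pos G u v) (neg G u v)
    toNeg : Fin (suc n) → Bool
    toNeg u = bySign s (neg G u v) (pos G u v)
    new : (Fin (suc n) → Bool) → Fin n → Fin n → Bool
    new f a b = ((ι b == w) ∧ not (ι a == w) ∧ f (ι a))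
              ∨ ((ι a == w) ∧ not (ι b == w) ∧ f (ι b))
    P : Fin n → Fin n → Bool
    P a b = pos G (ι a) (ι b) ∨ new toPos a b
    N : Fin n → Fin n → Bool
    N a b = neg G (ι a) (ι b) ∨ new toNeg a b
    extra : Bool
    extra = bySign s (neg G v w) (pos G v w)
    L : Fin n → Bool
    L a = loop G (ι a) ∨ ((ι a == w) ∧ (loop G v ∨ extra))

-- Colour set Λ_k = {0, ±1, …, ±k}, indexed by Fin (2k+1): i ↦ i - k.
colour : (k : ℕ) → Fin (suc (k Data.Nat.+ k)) → ℤ
colour k i = + Data.Fin.toℕ i - + k

allVecs : (m n : ℕ) → List (Vec (Fin m) n)
allVecs m zero    = []ᵥ ∷ []
allVecs m (suc n) = concatMap (λ c → map (c ∷ᵥ_) (allVecs m n)) (allFin m)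

infix 4 _==ℤ_
_==ℤ_ : ℤ → ℤ → Bool
x ==ℤ y = ⌊ x ℤP.≟ y ⌋

all : {A : Set} → (A → Bool) → List A → Bool
all p = foldr (λ x b → p x ∧ b) true

proper : {n : ℕ} → SGraph n → (k : ℕ) → (Fin n → ℤ) → Bool
proper {n} G k γ =
  all (λ u → all (λ v →
        (not (pos G u v) ∨ not (γ u ==ℤ γ v)) ∧
        (not (neg G u v) ∨ not (γ u ==ℤ (- γ v)))) (allFin n)) (allFin n)
  ∧ all (λ v → not (loop G v) ∨ not ((γ v ==ℤ + 0))) (allFin n)

-- number of proper k-colourings, i.e. χ(G, 2k+1)
numColourings : {n : ℕ} → SGraph n → ℕ → ℕ
numColourings {n} G k =
  length (filterᵇ (λ c → proper G k (λ x → colour k (lookup c x)))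
                  (allVecs (suc (k Data.Nat.+ k)) n))

-- integer polynomials as coefficient lists (constant term first); Horner evaluation
Poly : Set
Poly = List ℤ

eval : Poly → ℤ → ℤ
eval []       x = + 0
eval (c ∷ cs) x = c +ℤ x *ℤ eval cs x

-- χ(H,t) divides χ(G,t): there is a polynomial q with χ(G,t) = χ(H,t)·q(t),
-- expressed through the defining values χ(·, 2k+1), k ≥ 1.
ChromDivides : {m n : ℕ} → SGraph m → SGraph n → Set
ChromDivides H G = Σ Poly λ q → ∀ (k : ℕ) → 1 ≤ k →
  + numColourings G k ≡ + numColourings H k *ℤ eval q (+ suc (k Data.Nat.+ k))

Divisional : {n : ℕ} → SGraph (suc n) → Sign → Fin (suc n) → Fin (suc n) → Set
Divisional G s v w = ChromDivides (contract G s v w) G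

IsEdge : {n : ℕ} → SGraph n → Sign → Fin n → Fin n → Set
IsEdge G plus  v w = pos G v w ≡ true
IsEdge G minus v w = neg G v w ≡ true

module Submission where

--  (1) Simplicial elimination.  A colouring of G is a colouring of G ∖ v
--      together with a colour x for v, and it is proper iff the colouring of
--      G ∖ v is proper and x avoids the forbidden colours of v: γ(u) for
--      positive neighbours u, −γ(u) for negative neighbours u, and 0 if v is
--      looped.  When G ∖ v is properly coloured, conditions (a)–(c) make these
--      d = deg⁺ v + deg⁻ v + [v looped] colours pairwise distinct, so
--      χ(G, t) = (t − d) · χ(G ∖ v, t).
--  (2) Contraction adds nothing.  Every edge or loop that G/(v,w) creates at w
--      is already present in G by conditions (a)–(c), so G/(v,w) has exactly
--      the adjacency of G ∖ v and hence the same chromatic function.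
--
-- Hence χ(G, t) = (t − d) · χ(G/(v,w), t).

open import Defs
open import Data.Nat using (ℕ; zero; suc; _+_; _*_; _∸_; _≤_; s≤s)
import Data.Nat.Properties as NP
open import Algebra.Properties.CommutativeSemigroup NP.+-commutativeSemigroup using (interchange)
open import Data.Fin using (Fin; zero; suc; punchIn; punchOut; toℕ; opposite; fromℕ<)
import Data.Fin.Properties as FP
open import Data.Bool using (Bool; true; false; _∧_; _∨_; not; T; T?)
open import Data.List using (List; []; _∷_; map; concatMap; allFin; filterᵇ; length; tabulate; _++_)
open import Data.Bool.Properties using (∨-conicalˡ; ∨-conicalʳ)
import Data.List.Properties as LP
open import Data.Nat.ListAction using (sum)
import Data.Nat.ListAction.Properties as SP
open import Data.Vec using (Vec; lookup; insertAt) renaming (_∷_ to _∷ᵥ_)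
import Data.Vec.Properties as VP
open import Data.Integer using (ℤ; -_; _-_; _⊖_; -[1+_]) renaming (+_ to ℤ+; _+_ to _+ℤ_; _*_ to _*ℤ_)
import Data.Integer.Properties as ℤP
open import Data.Integer.Tactic.RingSolver using (solve-∀)
open import Data.Product using (Σ; _×_; _,_; proj₁; proj₂)
open import Data.Sum using (_⊎_; inj₁; inj₂; [_,_]′)
open import Data.Empty using (⊥-elim)
open import Data.Unit using (⊤; tt)
open import Function using (_∘_; id)
open import Relation.Nullary using (¬_; yes; no; contradiction)
open import Relation.Nullary.Decidable using (Dec; ⌊_⌋; isYes≗does; ⌊⌋-map′; dec-true; dec-false; toWitness)
open import Relation.Binary.PropositionalEquality

∨-elim : ∀ {a b} → a ∨ b ≡ true → a ≡ true ⊎ b ≡ true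
∨-elim {true}  _ = inj₁ refl
∨-elim {false} h = inj₂ h

∨-introˡ : ∀ {a b} → a ≡ true → a ∨ b ≡ true
∨-introˡ refl = refl

∨-introʳ : ∀ {a b} → b ≡ true → a ∨ b ≡ true
∨-introʳ {true}  _ = refl
∨-introʳ {false} h = h

∧-elim : ∀ {a b} → a ∧ b ≡ true → a ≡ true × b ≡ true
∧-elim {true} {true} _ = refl , refl

∧-elim₃ : ∀ {a b c} → a ∧ b ∧ c ≡ true → a ≡ true × b ≡ true × c ≡ true
∧-elim₃ {true} {true} {true} _ = refl , refl , refl

∧-intro : ∀ {a b} → a ≡ true → b ≡ true → a ∧ b ≡ true
∧-intro refl refl = refl

bool-ext : ∀ {a b} → (a ≡ true → b ≡ true) → (b ≡ true → a ≡ true) → a ≡ b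
bool-ext {true}          f _ = sym (f refl)
bool-ext {false} {true}  _ g = g refl
bool-ext {false} {false} _ _ = refl

true≢false : ∀ {a} → a ≡ true → a ≢ false
true≢false refl ()

not-false : ∀ {b} → b ≡ false → not b ≡ true
not-false refl = refl

not-true : ∀ {b} → not b ≡ true → b ≡ false
not-true {false} _ = refl

⌊⌋-true : {A : Set} (a? : Dec A) → A → ⌊ a? ⌋ ≡ true
⌊⌋-true a? a = trans (isYes≗does a?) (dec-true a? a)

⌊⌋-false : {A : Set} (a? : Dec A) → ¬ A → ⌊ a? ⌋ ≡ false
⌊⌋-false a? ¬a = trans (isYes≗does a?) (dec-false a? ¬a)

==⇒≡ : ∀ {m} (i j : Fin m) → (i == j) ≡ true → i ≡ j
==⇒≡ i j h = toWitness {a? = i FP.≟ j} (subst T (sym h) tt)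

==-refl : ∀ {m} (i : Fin m) → (i == i) ≡ true
==-refl i = ⌊⌋-true (i FP.≟ i) refl

≢⇒==-false : ∀ {m} {i j : Fin m} → i ≢ j → (i == j) ≡ false
≢⇒==-false {i = i} {j} = ⌊⌋-false (i FP.≟ j)

==-false⇒≢ : ∀ {m} {i j : Fin m} → (i == j) ≡ false → i ≢ j
==-false⇒≢ h refl = true≢false (==-refl _) h

==-suc : ∀ {m} (i j : Fin m) → (suc i == suc j) ≡ (i == j)
==-suc i j = ⌊⌋-map′ (cong suc) FP.suc-injective (i FP.≟ j)

guard⇒ : ∀ a (x y : ℤ) → (not a ∨ not (x ==ℤ y)) ≡ true → a ≡ true → x ≢ y
guard⇒ true x y h _ refl = true≢false h (cong not (⌊⌋-true (x ℤP.≟ x) refl))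

guard⇐ : ∀ a (x y : ℤ) → (a ≡ true → x ≢ y) → (not a ∨ not (x ==ℤ y)) ≡ true
guard⇐ false x y _ = refl
guard⇐ true  x y f rewrite ⌊⌋-false (x ℤP.≟ y) (f refl) = refl

all-tabulate⇒ : ∀ {A : Set} n (p : A → Bool) (f : Fin n → A) →
  all p (tabulate f) ≡ true → ∀ i → p (f i) ≡ true
all-tabulate⇒ (suc n) p f h zero    = proj₁ (∧-elim h)
all-tabulate⇒ (suc n) p f h (suc i) = all-tabulate⇒ n p (f ∘ suc) (proj₂ (∧-elim {p (f zero)} h)) i

all-tabulate⇐ : ∀ {A : Set} n (p : A → Bool) (f : Fin n → A) →
  (∀ i → p (f i) ≡ true) → all p (tabulate f) ≡ true
all-tabulate⇐ zero    p f h = refl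
all-tabulate⇐ (suc n) p f h = ∧-intro (h zero) (all-tabulate⇐ n p (f ∘ suc) (h ∘ suc))

all-cong : ∀ {A : Set} {p q : A → Bool} → (∀ x → p x ≡ q x) → ∀ xs → all p xs ≡ all q xs
all-cong h []       = refl
all-cong h (x ∷ xs) = cong₂ _∧_ (h x) (all-cong h xs)

ind : Bool → ℕ
ind true  = 1
ind false = 0

count : {A : Set} → (A → Bool) → List A → ℕ
count p xs = length (filterᵇ p xs)

count-∷ : {A : Set} (p : A → Bool) (x : A) (xs : List A) →
  count p (x ∷ xs) ≡ ind (p x) + count p xs
count-∷ p x xs with p x
... | true  = refl
... | false = refl

count-++ : {A : Set} (p : A → Bool) (xs ys : List A) → count p (xs ++ ys) ≡ count p xs + count p ys
count-++ p xs ys = trans (cong length (LP.filter-++ (T? ∘ p) xs ys)) (LP.length-++ (filterᵇ p xs))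

count-cong : {A : Set} {p q : A → Bool} → (∀ x → p x ≡ q x) → ∀ xs → count p xs ≡ count q xs
count-cong h []                   = refl
count-cong {p = p} {q} h (x ∷ xs) = begin
  count p (x ∷ xs)          ≡⟨ count-∷ p x xs ⟩
  ind (p x) + count p xs    ≡⟨ cong₂ _+_ (cong ind (h x)) (count-cong h xs) ⟩
  ind (q x) + count q xs    ≡⟨ count-∷ q x xs ⟨
  count q (x ∷ xs)          ∎
  where open ≡-Reasoning

count-map : {A B : Set} (p : B → Bool) (f : A → B) (xs : List A) → count p (map f xs) ≡ count (p ∘ f) xs
count-map p f []       = refl
count-map p f (x ∷ xs) =
  trans (count-∷ p (f x) (map f xs)) (trans (cong (ind (p (f x)) +_) (count-map p f xs)) (sym (count-∷ (p ∘ f) x xs)))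

count-none : {A : Set} (p : A → Bool) → (∀ x → p x ≡ false) → ∀ xs → count p xs ≡ 0
count-none p h []       = refl
count-none p h (x ∷ xs) = trans (count-∷ p x xs) (cong₂ _+_ (cong ind (h x)) (count-none p h xs))

count-witness : {A : Set} (p : A → Bool) (xs : List A) → count p xs ≢ 0 → Σ A λ x → p x ≡ true
count-witness p []       h = contradiction refl h
count-witness p (x ∷ xs) h = witness (h ∘ trans (count-∷ p x xs))
  where
  witness : ind (p x) + count p xs ≢ 0 → Σ _ λ y → p y ≡ true
  witness h′ with p x in px
  ... | true  = x , px
  ... | false = count-witness p xs h′

count-as-sum : {A : Set} (p : A → Bool) (xs : List A) → count p xs ≡ sum (map (ind ∘ p) xs)
count-as-sum p []       = refl
count-as-sum p (x ∷ xs) = trans (count-∷ p x xs) (cong (ind (p x) +_) (count-as-sum p xs))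

sum-cong : {A : Set} {f g : A → ℕ} → (∀ x → f x ≡ g x) → ∀ xs → sum (map f xs) ≡ sum (map g xs)
sum-cong h xs = cong sum (LP.map-cong h xs)

sum-+ : {A : Set} (f g : A → ℕ) (xs : List A) →
  sum (map (λ x → f x + g x) xs) ≡ sum (map f xs) + sum (map g xs)
sum-+ f g []       = refl
sum-+ f g (x ∷ xs) = trans (cong (f x + g x +_) (sum-+ f g xs))
                            (interchange (f x) (g x) (sum (map f xs)) (sum (map g xs)))

sum-swap : {A B : Set} (f : A → B → ℕ) (as : List A) (bs : List B) →
  sum (map (λ a → sum (map (f a) bs)) as) ≡ sum (map (λ b → sum (map (λ a → f a b) as)) bs)
sum-swap f []       bs = sym (zeros bs)
  where
  zeros : ∀ {B : Set} (bs : List B) → sum (map (λ _ → 0) bs) ≡ 0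
  zeros []       = refl
  zeros (_ ∷ bs) = zeros bs
sum-swap f (a ∷ as) bs =
  trans (cong (sum (map (f a) bs) +_) (sum-swap f as bs)) (sym (sum-+ (f a) (λ b → sum (map (λ a → f a b) as)) bs))

count-swap : {A B : Set} (p : A → B → Bool) (as : List A) (bs : List B) →
  sum (map (λ a → count (p a) bs) as) ≡ sum (map (λ b → count (λ a → p a b) as) bs)
count-swap p as bs = begin
  sum (map (λ a → count (p a) bs) as)                       ≡⟨ sum-cong (λ a → count-as-sum (p a) bs) as ⟩
  sum (map (λ a → sum (map (ind ∘ p a) bs)) as)             ≡⟨ sum-swap (λ a b → ind (p a b)) as bs ⟩
  sum (map (λ b → sum (map (λ a → ind (p a b)) as)) bs)     ≡⟨ sum-cong (λ b → count-as-sum (λ a → p a b) as) bs ⟨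
  sum (map (λ b → count (λ a → p a b) as) bs)               ∎
  where open ≡-Reasoning

sum-concatMap : {A B : Set} (g : B → ℕ) (f : A → List B) (xs : List A) →
  sum (map g (concatMap f xs)) ≡ sum (map (λ x → sum (map g (f x))) xs)
sum-concatMap g f []       = refl
sum-concatMap g f (x ∷ xs) = begin
  sum (map g (f x ++ concatMap f xs))                   ≡⟨ cong sum (LP.map-++ g (f x) (concatMap f xs)) ⟩
  sum (map g (f x) ++ map g (concatMap f xs))           ≡⟨ SP.sum-++ (map g (f x)) _ ⟩
  sum (map g (f x)) + sum (map g (concatMap f xs))      ≡⟨ cong (sum (map g (f x)) +_) (sum-concatMap g f xs) ⟩
  sum (map g (f x)) + sum (map (λ x → sum (map g (f x))) xs) ∎
  where open ≡-Reasoning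

count-concatMap : {A B : Set} (p : B → Bool) (f : A → List B) (xs : List A) →
  count p (concatMap f xs) ≡ sum (map (λ x → count p (f x)) xs)
count-concatMap p f []       = refl
count-concatMap p f (x ∷ xs) =
  trans (count-++ p (f x) (concatMap f xs)) (cong (count p (f x) +_) (count-concatMap p f xs))

sum-indicator-* : {A : Set} (p : A → Bool) (r : ℕ) (xs : List A) →
  sum (map (λ x → ind (p x) * r) xs) ≡ count p xs * r
sum-indicator-* p r []       = refl
sum-indicator-* p r (x ∷ xs) = begin
  ind (p x) * r + sum (map (λ x → ind (p x) * r) xs) ≡⟨ cong (ind (p x) * r +_) (sum-indicator-* p r xs) ⟩
  ind (p x) * r + count p xs * r                     ≡⟨ NP.*-distribʳ-+ r (ind (p x)) (count p xs) ⟨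
  (ind (p x) + count p xs) * r                       ≡⟨ cong (_* r) (count-∷ p x xs) ⟨
  count p (x ∷ xs) * r                               ∎
  where open ≡-Reasoning

-- Counting over all vectors: a vector in Fin m ^ (suc n) is a vector in
-- Fin m ^ n with one entry x inserted at position v.
count-insertAt : ∀ m n (v : Fin (suc n)) (P : Vec (Fin m) (suc n) → Bool) →
  count P (allVecs m (suc n)) ≡ sum (map (λ c → count (λ x → P (insertAt c v x)) (allFin m)) (allVecs m n))
count-insertAt m n zero P = begin
  count P (concatMap (λ x → map (x ∷ᵥ_) (allVecs m n)) (allFin m))
    ≡⟨ count-concatMap P (λ x → map (x ∷ᵥ_) (allVecs m n)) (allFin m) ⟩
  sum (map (λ x → count P (map (x ∷ᵥ_) (allVecs m n))) (allFin m))
    ≡⟨ sum-cong (λ x → count-map P (x ∷ᵥ_) (allVecs m n)) (allFin m) ⟩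
  sum (map (λ x → count (λ c → P (x ∷ᵥ c)) (allVecs m n)) (allFin m))
    ≡⟨ count-swap (λ x c → P (x ∷ᵥ c)) (allFin m) (allVecs m n) ⟩
  sum (map (λ c → count (λ x → P (x ∷ᵥ c)) (allFin m)) (allVecs m n)) ∎
  where open ≡-Reasoning
count-insertAt m (suc n) (suc v) P = begin
  count P (concatMap (λ y → map (y ∷ᵥ_) (allVecs m (suc n))) (allFin m))
    ≡⟨ count-concatMap P (λ y → map (y ∷ᵥ_) (allVecs m (suc n))) (allFin m) ⟩
  sum (map (λ y → count P (map (y ∷ᵥ_) (allVecs m (suc n)))) (allFin m))
    ≡⟨ sum-cong (λ y → trans (count-map P (y ∷ᵥ_) (allVecs m (suc n)))
                             (count-insertAt m n v (λ c → P (y ∷ᵥ c)))) (allFin m) ⟩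
  sum (map (λ y → sum (map (g ∘ (y ∷ᵥ_)) (allVecs m n))) (allFin m))
    ≡⟨ sum-cong (λ y → cong sum (LP.map-∘ (allVecs m n))) (allFin m) ⟩
  sum (map (λ y → sum (map g (map (y ∷ᵥ_) (allVecs m n)))) (allFin m))
    ≡⟨ sum-concatMap g (λ y → map (y ∷ᵥ_) (allVecs m n)) (allFin m) ⟨
  sum (map g (allVecs m (suc n))) ∎
  where
  open ≡-Reasoning
  g : Vec (Fin m) (suc n) → ℕ
  g c = count (λ x → P (insertAt c (suc v) x)) (allFin m)

count-tabulate : ∀ {A : Set} m (p : A → Bool) (f : Fin m → A) →
  count p (tabulate f) ≡ count (p ∘ f) (allFin m)
count-tabulate zero    p f = refl
count-tabulate (suc m) p f = begin
  count p (tabulate f)                                ≡⟨ count-∷ p (f zero) (tabulate (f ∘ suc)) ⟩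
  ind (p (f zero)) + count p (tabulate (f ∘ suc))     ≡⟨ cong (ind (p (f zero)) +_) (count-tabulate m p (f ∘ suc)) ⟩
  ind (p (f zero)) + count (p ∘ f ∘ suc) (allFin m)   ≡⟨ cong (ind (p (f zero)) +_) (count-tabulate m (p ∘ f) suc) ⟨
  ind (p (f zero)) + count (p ∘ f) (tabulate suc)     ≡⟨ count-∷ (p ∘ f) zero (tabulate suc) ⟨
  count (p ∘ f) (allFin (suc m))                      ∎
  where open ≡-Reasoning

count-== : ∀ m (f : Fin m) → count (_== f) (allFin m) ≡ 1
count-== (suc m) zero    =
  cong suc (trans (count-tabulate m (_== zero) suc) (count-none _ (λ _ → refl) (allFin m)))
count-== (suc m) (suc f) =
  trans (count-tabulate m (_== suc f) suc) (trans (count-cong (λ x → ==-suc x f) (allFin m)) (count-== m f))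

_∈ᵇ_ : ∀ {m} → Fin m → List (Fin m) → Bool
x ∈ᵇ []      = false
x ∈ᵇ (f ∷ F) = (x == f) ∨ (x ∈ᵇ F)

NoDup : ∀ {m} → List (Fin m) → Set
NoDup []      = ⊤
NoDup (f ∷ F) = (f ∈ᵇ F) ≡ false × NoDup F

count-not+count : {A : Set} (p : A → Bool) (xs : List A) → count (not ∘ p) xs + count p xs ≡ length xs
count-not+count p []       = refl
count-not+count p (x ∷ xs) = begin
  count (not ∘ p) (x ∷ xs) + count p (x ∷ xs)
    ≡⟨ cong₂ _+_ (count-∷ (not ∘ p) x xs) (count-∷ p x xs) ⟩
  ind (not (p x)) + count (not ∘ p) xs + (ind (p x) + count p xs)
    ≡⟨ split-indicator (p x) _ _ ⟩
  suc (count (not ∘ p) xs + count p xs)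
    ≡⟨ cong suc (count-not+count p xs) ⟩
  length (x ∷ xs) ∎
  where
  open ≡-Reasoning
  split-indicator : ∀ b a c → ind (not b) + a + (ind b + c) ≡ suc (a + c)
  split-indicator true  a c = NP.+-suc a c
  split-indicator false a c = refl

count-∈ᵇ : ∀ m (F : List (Fin m)) → NoDup F → count (_∈ᵇ F) (allFin m) ≡ length F
count-∈ᵇ m []      _           = count-none _ (λ _ → refl) (allFin m)
count-∈ᵇ m (f ∷ F) (f∉F , nd) = begin
  count (_∈ᵇ (f ∷ F)) (allFin m)                  ≡⟨ count-as-sum (_∈ᵇ (f ∷ F)) (allFin m) ⟩
  sum (map (ind ∘ (_∈ᵇ (f ∷ F))) (allFin m))      ≡⟨ sum-cong disjoint (allFin m) ⟩
  sum (map (λ x → ind (x == f) + ind (x ∈ᵇ F)) (allFin m))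
    ≡⟨ sum-+ (ind ∘ (_== f)) (ind ∘ (_∈ᵇ F)) (allFin m) ⟩
  sum (map (ind ∘ (_== f)) (allFin m)) + sum (map (ind ∘ (_∈ᵇ F)) (allFin m))
    ≡⟨ cong₂ _+_ (count-as-sum (_== f) (allFin m)) (count-as-sum (_∈ᵇ F) (allFin m)) ⟨
  count (_== f) (allFin m) + count (_∈ᵇ F) (allFin m)
    ≡⟨ cong₂ _+_ (count-== m f) (count-∈ᵇ m F nd) ⟩
  suc (length F) ∎
  where
  open ≡-Reasoning
  -- x = f and x ∈ F are exclusive since f ∉ F
  disjoint : ∀ x → ind (x ∈ᵇ (f ∷ F)) ≡ ind (x == f) + ind (x ∈ᵇ F)
  disjoint x with x FP.≟ f
  ... | yes refl rewrite ==-refl f | f∉F = refl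
  ... | no x≢f   rewrite ≢⇒==-false x≢f  = refl

-- Hence m − length F elements avoid F (stated without truncated subtraction).
count-avoiding : ∀ m (F : List (Fin m)) → NoDup F → count (not ∘ (_∈ᵇ F)) (allFin m) + length F ≡ m
count-avoiding m F nd = begin
  avoiding + length F                     ≡⟨ cong (avoiding +_) (count-∈ᵇ m F nd) ⟨
  avoiding + count (_∈ᵇ F) (allFin m)     ≡⟨ count-not+count (_∈ᵇ F) (allFin m) ⟩
  length (allFin m)                       ≡⟨ LP.length-tabulate id ⟩
  m                                       ∎
  where
  open ≡-Reasoning
  avoiding = count (not ∘ (_∈ᵇ F)) (allFin m)

-- Conditional cons, and the signed image of c : Fin n → Fin m on index sets
-- p and q: the values c i for p i together with opposite (c i) for q i.
-- (On the palette, opposite realises the sign change of colours.)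

when : {A : Set} → Bool → A → List A → List A
when true  y ys = y ∷ ys
when false y ys = ys

signedImage : ∀ {m} n → (p q : Fin n → Bool) → (Fin n → Fin m) → List (Fin m)
signedImage zero    p q c = []
signedImage (suc n) p q c =
  when (p zero) (c zero) (when (q zero) (opposite (c zero)) (signedImage n (p ∘ suc) (q ∘ suc) (c ∘ suc)))

size : ∀ n → (Fin n → Bool) → ℕ
size zero    p = 0
size (suc n) p = ind (p zero) + size n (p ∘ suc)

∉-when⇒ : ∀ {m} (x y : Fin m) b ys → (x ∈ᵇ when b y ys) ≡ false →
  (b ≡ true → x ≢ y) × (x ∈ᵇ ys) ≡ false
∉-when⇒ x y false ys h = (λ ()) , h
∉-when⇒ x y true  ys h = (λ _ → ==-false⇒≢ (∨-conicalˡ _ _ h)) , ∨-conicalʳ _ _ h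

∉-when⇐ : ∀ {m} (x y : Fin m) b ys → (b ≡ true → x ≢ y) → (x ∈ᵇ ys) ≡ false →
  (x ∈ᵇ when b y ys) ≡ false
∉-when⇐ x y false ys _ h = h
∉-when⇐ x y true  ys f h rewrite ≢⇒==-false (f refl) = h

length-when : {A : Set} (b : Bool) (y : A) (ys : List A) → length (when b y ys) ≡ ind b + length ys
length-when true  y ys = refl
length-when false y ys = refl

noDup-when : ∀ {m} b (y : Fin m) ys → (b ≡ true → (y ∈ᵇ ys) ≡ false) → NoDup ys → NoDup (when b y ys)
noDup-when true  y ys f nd = f refl , nd
noDup-when false y ys f nd = nd

opposite-injective : ∀ {m} {i j : Fin m} → opposite i ≡ opposite j → i ≡ j
opposite-injective {i = i} {j} eq =
  trans (sym (FP.opposite-involutive i)) (trans (cong opposite eq) (FP.opposite-involutive j))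

Avoids : ∀ {m n} → Fin m → (p q : Fin n → Bool) → (Fin n → Fin m) → Set
Avoids x p q c = ∀ i → (p i ≡ true → x ≢ c i) × (q i ≡ true → x ≢ opposite (c i))

∉-signedImage⇒ : ∀ {m} n p q c (x : Fin m) → (x ∈ᵇ signedImage n p q c) ≡ false → Avoids x p q c
∉-signedImage⇒ (suc n) p q c x h i with ∉-when⇒ x _ (p zero) _ h
... | x≢c₀ , h′ with ∉-when⇒ x _ (q zero) _ h′
... | x≢-c₀ , h″ with i
... | zero  = x≢c₀ , x≢-c₀
... | suc j = ∉-signedImage⇒ n (p ∘ suc) (q ∘ suc) (c ∘ suc) x h″ j

∉-signedImage⇐ : ∀ {m} n p q c (x : Fin m) → Avoids x p q c → (x ∈ᵇ signedImage n p q c) ≡ false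
∉-signedImage⇐ zero    p q c x _ = refl
∉-signedImage⇐ (suc n) p q c x h =
  ∉-when⇐ x _ (p zero) _ (proj₁ (h zero))
    (∉-when⇐ x _ (q zero) _ (proj₂ (h zero)) (∉-signedImage⇐ n (p ∘ suc) (q ∘ suc) (c ∘ suc) x (h ∘ suc)))

length-signedImage : ∀ {m} n p q (c : Fin n → Fin m) → length (signedImage n p q c) ≡ size n p + size n q
length-signedImage zero    p q c = refl
length-signedImage (suc n) p q c = begin
  length (when (p zero) _ (when (q zero) _ rest))  ≡⟨ length-when (p zero) _ _ ⟩
  ind (p zero) + length (when (q zero) _ rest)     ≡⟨ cong (ind (p zero) +_) (length-when (q zero) _ rest) ⟩
  ind (p zero) + (ind (q zero) + length rest)      ≡⟨ cong (λ z → ind (p zero) + (ind (q zero) + z)) (length-signedImage n _ _ _) ⟩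
  ind (p zero) + (ind (q zero) + (P + Q))          ≡⟨ NP.+-assoc (ind (p zero)) (ind (q zero)) (P + Q) ⟨
  ind (p zero) + ind (q zero) + (P + Q)            ≡⟨ interchange (ind (p zero)) (ind (q zero)) P Q ⟩
  ind (p zero) + P + (ind (q zero) + Q)            ∎
  where
  open ≡-Reasoning
  rest = signedImage n (p ∘ suc) (q ∘ suc) (c ∘ suc)
  P = size n (p ∘ suc)
  Q = size n (q ∘ suc)

noDup-signedImage : ∀ {m} n p q (c : Fin n → Fin m) →
  (∀ i j → i ≢ j → p i ≡ true → p j ≡ true → c i ≢ c j) →
  (∀ i j → p i ≡ true → q j ≡ true → c i ≢ opposite (c j)) →
  (∀ i j → i ≢ j → q i ≡ true → q j ≡ true → c i ≢ c j) →
  NoDup (signedImage n p q c)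
noDup-signedImage zero    p q c _ _ _ = tt
noDup-signedImage (suc n) p q c sepP sepPQ sepQ =
  noDup-when (p zero) (c zero) _
    (λ p₀ → ∉-when⇐ (c zero) _ (q zero) _ (λ q₀ → sepPQ zero zero p₀ q₀)
       (∉-signedImage⇐ n _ _ _ (c zero) λ i →
          (λ pᵢ → sepP zero (suc i) (λ ()) p₀ pᵢ) , (λ qᵢ → sepPQ zero (suc i) p₀ qᵢ)))
    (noDup-when (q zero) (opposite (c zero)) _
       (λ q₀ → ∉-signedImage⇐ n _ _ _ (opposite (c zero)) λ i →
          (λ pᵢ eq → sepPQ (suc i) zero pᵢ q₀ (sym eq)) ,
          (λ qᵢ eq → sepQ zero (suc i) (λ ()) q₀ qᵢ (opposite-injective eq)))
       (noDup-signedImage n (p ∘ suc) (q ∘ suc) (c ∘ suc)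
          (λ i j i≢j → sepP (suc i) (suc j) (i≢j ∘ FP.suc-injective))
          (λ i j → sepPQ (suc i) (suc j))
          (λ i j i≢j → sepQ (suc i) (suc j) (i≢j ∘ FP.suc-injective))))

Palette : ℕ → Set
Palette k = Fin (suc (k + k))

colour-injective : ∀ k {i j : Palette k} → colour k i ≡ colour k j → i ≡ j
colour-injective k {i} {j} eq = FP.toℕ-injective (ℤP.+-injective (begin
  ℤ+ (toℕ i)              ≡⟨ shift (ℤ+ (toℕ i)) (ℤ+ k) ⟨
  colour k i +ℤ ℤ+ k      ≡⟨ cong (_+ℤ ℤ+ k) eq ⟩
  colour k j +ℤ ℤ+ k      ≡⟨ shift (ℤ+ (toℕ j)) (ℤ+ k) ⟩
  ℤ+ (toℕ j)              ∎))
  where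
  open ≡-Reasoning
  shift : ∀ a b → a - b +ℤ b ≡ a
  shift = solve-∀

zeroColour : ∀ k → Palette k
zeroColour k = fromℕ< (s≤s (NP.m≤m+n k k))

colour-zeroColour : ∀ k → colour k (zeroColour k) ≡ ℤ+ 0
colour-zeroColour k = trans (cong (λ z → ℤ+ z - ℤ+ k) (FP.toℕ-fromℕ< (s≤s (NP.m≤m+n k k)))) (cancel (ℤ+ k))
  where
  cancel : ∀ a → a - a ≡ ℤ+ 0
  cancel = solve-∀

colour-opposite : ∀ k (i : Palette k) → colour k (opposite i) ≡ - colour k i
colour-opposite k i = begin
  ℤ+ (toℕ (opposite i)) - ℤ+ k            ≡⟨ cong (λ z → ℤ+ z - ℤ+ k) (FP.opposite-prop i) ⟩
  ℤ+ ((k + k) ∸ toℕ i) - ℤ+ k             ≡⟨ cong (_- ℤ+ k) (ℤP.⊖-≥ (NP.≤-pred (FP.toℕ<n i))) ⟨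
  ((k + k) ⊖ toℕ i) - ℤ+ k                ≡⟨ cong (_- ℤ+ k) (ℤP.m-n≡m⊖n (k + k) (toℕ i)) ⟨
  ((ℤ+ k +ℤ ℤ+ k) - ℤ+ (toℕ i)) - ℤ+ k    ≡⟨ reflect (ℤ+ (toℕ i)) (ℤ+ k) ⟩
  - (ℤ+ (toℕ i) - ℤ+ k)                   ∎
  where
  open ≡-Reasoning
  reflect : ∀ a b → ((b +ℤ b) - a) - b ≡ - (a - b)
  reflect = solve-∀

self-opposite : ∀ (x : ℤ) → x ≡ - x → x ≡ ℤ+ 0
self-opposite (ℤ+ zero)    _ = refl
self-opposite (ℤ+ (suc n)) ()
self-opposite -[1+ n ]     ()

neg-swap : ∀ {x y : ℤ} → x ≡ - y → y ≡ - x
neg-swap {x} {y} eq = trans (sym (ℤP.neg-involutive y)) (cong -_ (sym eq))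

record Proper {n : ℕ} (G : SGraph n) (γ : Fin n → ℤ) : Set where
  field
    pos-ok  : ∀ u u′ → pos G u u′ ≡ true → γ u ≢ γ u′
    neg-ok  : ∀ u u′ → neg G u u′ ≡ true → γ u ≢ - γ u′
    loop-ok : ∀ u → loop G u ≡ true → γ u ≢ ℤ+ 0

proper⇒Proper : ∀ {n} (G : SGraph n) k γ → proper G k γ ≡ true → Proper G γ
proper⇒Proper {n} G k γ h = record
  { pos-ok  = λ u u′ → guard⇒ (pos G u u′) _ _ (proj₁ (∧-elim (edges u u′)))
  ; neg-ok  = λ u u′ → guard⇒ (neg G u u′) _ _ (proj₂ (∧-elim {not (pos G u u′) ∨ _} (edges u u′)))
  ; loop-ok = λ u → guard⇒ (loop G u) _ _ (all-tabulate⇒ n _ id (proj₂ (∧-elim {all _ (allFin n)} h)) u)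
  }
  where
  edges : ∀ u u′ → (not (pos G u u′) ∨ not (γ u ==ℤ γ u′)) ∧ (not (neg G u u′) ∨ not (γ u ==ℤ - γ u′)) ≡ true
  edges u u′ = all-tabulate⇒ n _ id (all-tabulate⇒ n _ id (proj₁ (∧-elim h)) u) u′

Proper⇒proper : ∀ {n} (G : SGraph n) k γ → Proper G γ → proper G k γ ≡ true
Proper⇒proper {n} G k γ P = ∧-intro
  (all-tabulate⇐ n _ id λ u → all-tabulate⇐ n _ id λ u′ →
     ∧-intro (guard⇐ (pos G u u′) _ _ (pos-ok u u′)) (guard⇐ (neg G u u′) _ _ (neg-ok u u′)))
  (all-tabulate⇐ n _ id λ u → guard⇐ (loop G u) _ _ (loop-ok u))
  where open Proper P

-- The linear polynomial t − d, and the passage from ℕ to ℤ: truncated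
-- subtraction m ∸ d agrees with m − d as soon as d ≤ m, which need only hold
-- when the factor N is nonzero.

linear : ℕ → Poly
linear d = (- ℤ+ d) ∷ ℤ+ 1 ∷ []

eval-linear : ∀ d (t : ℤ) → eval (linear d) t ≡ t - ℤ+ d
eval-linear d t = normalise (ℤ+ d) t
  where
  normalise : ∀ D t → - D +ℤ t *ℤ (ℤ+ 1 +ℤ t *ℤ ℤ+ 0) ≡ t - D
  normalise = solve-∀

times-linear : ∀ N m d → (N ≢ 0 → d ≤ m) → ℤ+ (N * (m ∸ d)) ≡ ℤ+ N *ℤ eval (linear d) (ℤ+ m)
times-linear zero      m d _     = refl
times-linear N@(suc _) m d d≤m = begin
  ℤ+ (N * (m ∸ d))         ≡⟨ ℤP.pos-* N (m ∸ d) ⟩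
  ℤ+ N *ℤ ℤ+ (m ∸ d)       ≡⟨ cong (ℤ+ N *ℤ_) (ℤP.⊖-≥ (d≤m (λ ()))) ⟨
  ℤ+ N *ℤ (m ⊖ d)          ≡⟨ cong (ℤ+ N *ℤ_) (ℤP.m-n≡m⊖n m d) ⟨
  ℤ+ N *ℤ (ℤ+ m - ℤ+ d)    ≡⟨ cong (ℤ+ N *ℤ_) (eval-linear d (ℤ+ m)) ⟨
  ℤ+ N *ℤ eval (linear d) (ℤ+ m) ∎
  where open ≡-Reasoning

delete : ∀ {n} → SGraph (suc n) → Fin (suc n) → SGraph n
delete G v = record
  { pos  = λ a b → pos G (punchIn v a) (punchIn v b)
  ; neg  = λ a b → neg G (punchIn v a) (punchIn v b)
  ; loop = λ a → loop G (punchIn v a)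
  }

module Elimination {n : ℕ} (G : SGraph (suc n)) (wf : WellFormed G) (v : Fin (suc n)) where
  open WellFormed wf

  ι : Fin n → Fin (suc n)
  ι = punchIn v

  data Position (u : Fin (suc n)) : Set where
    at-v  : u ≡ v → Position u
    off-v : (a : Fin n) → u ≡ ι a → Position u

  position : ∀ u → Position u
  position u with v FP.≟ u
  ... | yes v≡u = at-v (sym v≡u)
  ... | no v≢u  = off-v (punchOut v≢u) (sym (FP.punchIn-punchOut v≢u))

  posNbr negNbr : Fin n → Bool
  posNbr a = pos G v (ι a)
  negNbr a = neg G v (ι a)

  degree : ℕ
  degree = ind (loop G v) + (size n posNbr + size n negNbr)

  module Colouring (k : ℕ) where
    m : ℕ
    m = suc (k + k)

    ⟦_⟧ : ∀ {r} → Vec (Palette k) r → Fin r → ℤ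
    ⟦ c ⟧ u = colour k (lookup c u)

    forbidden : Vec (Palette k) n → List (Palette k)
    forbidden c = when (loop G v) (zeroColour k) (signedImage n posNbr negNbr (lookup c))

    length-forbidden : ∀ c → length (forbidden c) ≡ degree
    length-forbidden c =
      trans (length-when (loop G v) _ _) (cong (ind (loop G v) +_) (length-signedImage n posNbr negNbr (lookup c)))

    module Extension (c : Vec (Palette k) n) (x : Palette k) where
      γ : Fin (suc n) → ℤ
      γ = ⟦ insertAt c v x ⟧

      γ-v : γ v ≡ colour k x
      γ-v = cong (colour k) (VP.insertAt-lookup c v x)

      γ-ι : ∀ a → γ (ι a) ≡ ⟦ c ⟧ a
      γ-ι a = cong (colour k) (VP.insertAt-punchIn c v x a)

      restrict : Proper G γ → Proper (delete G v) ⟦ c ⟧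
      restrict P = record
        { pos-ok  = λ a b h eq → pos-ok (ι a) (ι b) h (trans (γ-ι a) (trans eq (sym (γ-ι b))))
        ; neg-ok  = λ a b h eq → neg-ok (ι a) (ι b) h (trans (γ-ι a) (trans eq (cong -_ (sym (γ-ι b)))))
        ; loop-ok = λ a h eq → loop-ok (ι a) h (trans (γ-ι a) eq)
        }
        where open Proper P

      allowed : Proper G γ → (x ∈ᵇ forbidden c) ≡ false
      allowed P = ∉-when⇐ x (zeroColour k) (loop G v) _
        (λ lv x≡0 → loop-ok v lv (trans γ-v (trans (cong (colour k) x≡0) (colour-zeroColour k))))
        (∉-signedImage⇐ n posNbr negNbr (lookup c) x λ a →
          (λ p x≡ca → pos-ok v (ι a) p (trans γ-v (trans (cong (colour k) x≡ca) (sym (γ-ι a))))) ,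
          (λ q x≡-ca → neg-ok v (ι a) q (trans γ-v (trans (cong (colour k) x≡-ca)
                         (trans (colour-opposite k _) (cong -_ (sym (γ-ι a))))))))
        where open Proper P

      extend : Proper (delete G v) ⟦ c ⟧ → (x ∈ᵇ forbidden c) ≡ false → Proper G γ
      extend Q x∉ = record { pos-ok = pos-ok′ ; neg-ok = neg-ok′ ; loop-ok = loop-ok′ }
        where
        open Proper Q
        x≢0 : loop G v ≡ true → x ≢ zeroColour k
        x≢0 = proj₁ (∉-when⇒ x _ (loop G v) _ x∉)
        avoids : Avoids x posNbr negNbr (lookup c)
        avoids = ∉-signedImage⇒ n posNbr negNbr (lookup c) x (proj₂ (∉-when⇒ x _ (loop G v) _ x∉))
        x≡opposite : ∀ a → colour k x ≡ - ⟦ c ⟧ a → x ≡ opposite (lookup c a)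
        x≡opposite a eq = colour-injective k (trans eq (sym (colour-opposite k _)))

        pos-ok′ : ∀ u u′ → pos G u u′ ≡ true → γ u ≢ γ u′
        pos-ok′ u u′ h with position u | position u′
        ... | at-v refl    | at-v refl    = ⊥-elim (true≢false h (pos-irr v))
        ... | at-v refl    | off-v b refl = λ eq → proj₁ (avoids b) h
                                              (colour-injective k (trans (sym γ-v) (trans eq (γ-ι b))))
        ... | off-v a refl | at-v refl    = λ eq → proj₁ (avoids a) (trans (pos-sym v (ι a)) h)
                                              (colour-injective k (trans (sym γ-v) (trans (sym eq) (γ-ι a))))
        ... | off-v a refl | off-v b refl = λ eq → pos-ok a b h (trans (sym (γ-ι a)) (trans eq (γ-ι b)))

        neg-ok′ : ∀ u u′ → neg G u u′ ≡ true → γ u ≢ - γ u′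
        neg-ok′ u u′ h with position u | position u′
        ... | at-v refl    | at-v refl    = ⊥-elim (true≢false h (neg-irr v))
        ... | at-v refl    | off-v b refl = λ eq → proj₂ (avoids b) h
                                              (x≡opposite b (trans (sym γ-v) (trans eq (cong -_ (γ-ι b)))))
        ... | off-v a refl | at-v refl    = λ eq → proj₂ (avoids a) (trans (neg-sym v (ι a)) h)
                                              (x≡opposite a (trans (sym γ-v) (trans (neg-swap eq) (cong -_ (γ-ι a)))))
        ... | off-v a refl | off-v b refl = λ eq → neg-ok a b h (trans (sym (γ-ι a)) (trans eq (cong -_ (γ-ι b))))

        loop-ok′ : ∀ u → loop G u ≡ true → γ u ≢ ℤ+ 0
        loop-ok′ u h with position u
        ... | at-v refl    = λ eq → x≢0 h (colour-injective k (trans (sym γ-v) (trans eq (sym (colour-zeroColour k)))))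
        ... | off-v a refl = λ eq → loop-ok a h (trans (sym (γ-ι a)) eq)

      proper-insertAt : proper G k γ ≡ proper (delete G v) k ⟦ c ⟧ ∧ not (x ∈ᵇ forbidden c)
      proper-insertAt = bool-ext
        (λ h → let P = proper⇒Proper G k γ h in
               ∧-intro (Proper⇒proper (delete G v) k ⟦ c ⟧ (restrict P)) (not-false (allowed P)))
        (λ h → let (proper-c , x-allowed) = ∧-elim h in
               Proper⇒proper G k γ (extend (proper⇒Proper (delete G v) k ⟦ c ⟧ proper-c) (not-true x-allowed)))

    open Extension using (proper-insertAt)

    extensions : ∀ c → (proper (delete G v) k ⟦ c ⟧ ≡ true → NoDup (forbidden c)) →
      count (λ x → proper G k ⟦ insertAt c v x ⟧) (allFin m) ≡ ind (proper (delete G v) k ⟦ c ⟧) * (m ∸ degree)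
    extensions c distinct =
      trans (count-cong (proper-insertAt c) (allFin m)) (by-cases (proper (delete G v) k ⟦ c ⟧) refl)
      where
      open ≡-Reasoning
      by-cases : ∀ b → proper (delete G v) k ⟦ c ⟧ ≡ b →
        count (λ x → b ∧ not (x ∈ᵇ forbidden c)) (allFin m) ≡ ind b * (m ∸ degree)
      by-cases false _        = count-none _ (λ _ → refl) (allFin m)
      by-cases true  proper-c = begin
        avoiding                              ≡⟨ NP.m+n∸n≡m avoiding (length (forbidden c)) ⟨
        avoiding + length (forbidden c) ∸ length (forbidden c)
          ≡⟨ cong₂ _∸_ (count-avoiding m (forbidden c) (distinct proper-c)) (length-forbidden c) ⟩
        m ∸ degree                            ≡⟨ NP.+-identityʳ (m ∸ degree) ⟨
        ind true * (m ∸ degree)               ∎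
        where avoiding = count (not ∘ (_∈ᵇ forbidden c)) (allFin m)

    degree≤m : ∀ c → NoDup (forbidden c) → degree ≤ m
    degree≤m c distinct = subst₂ _≤_ (length-forbidden c) (count-avoiding m (forbidden c) distinct)
      (NP.m≤n+m (length (forbidden c)) _)

    elimination : (∀ c → proper (delete G v) k ⟦ c ⟧ ≡ true → NoDup (forbidden c)) →
      ℤ+ (numColourings G k) ≡ ℤ+ (numColourings (delete G v) k) *ℤ eval (linear degree) (ℤ+ m)
    elimination distinct = begin
      ℤ+ (numColourings G k)
        ≡⟨ cong ℤ+ (count-insertAt m n v (λ c → proper G k ⟦ c ⟧)) ⟩
      ℤ+ (sum (map (λ c → count (λ x → proper G k ⟦ insertAt c v x ⟧) (allFin m)) (allVecs m n)))
        ≡⟨ cong ℤ+ (sum-cong (λ c → extensions c (distinct c)) (allVecs m n)) ⟩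
      ℤ+ (sum (map (λ c → ind (properOnRest c) * (m ∸ degree)) (allVecs m n)))
        ≡⟨ cong ℤ+ (sum-indicator-* properOnRest (m ∸ degree) (allVecs m n)) ⟩
      ℤ+ (numColourings (delete G v) k * (m ∸ degree))
        ≡⟨ times-linear (numColourings (delete G v) k) m degree fits ⟩
      ℤ+ (numColourings (delete G v) k) *ℤ eval (linear degree) (ℤ+ m) ∎
      where
      open ≡-Reasoning
      properOnRest : Vec (Palette k) n → Bool
      properOnRest c = proper (delete G v) k ⟦ c ⟧
      -- a proper colouring of G ∖ v exists, and its forbidden colours fit
      fits : numColourings (delete G v) k ≢ 0 → degree ≤ m
      fits nonzero with count-witness properOnRest (allVecs m n) nonzero
      ... | c , proper-c = degree≤m c (distinct c proper-c)

  module Simplicial (ss : SignedSimplicial G v) where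
    open SignedSimplicial ss

    ι-≢ : ∀ {a b} → a ≢ b → ι a ≢ ι b
    ι-≢ {a} {b} a≢b = a≢b ∘ FP.punchIn-injective v a b

    posNbr-sym : ∀ a → posNbr a ≡ true → pos G (ι a) v ≡ true
    posNbr-sym a = trans (pos-sym (ι a) v)

    negNbr-sym : ∀ a → negNbr a ≡ true → neg G (ι a) v ≡ true
    negNbr-sym a = trans (neg-sym (ι a) v)

    forbidden-distinct : ∀ k c → proper (delete G v) k (Colouring.⟦_⟧ k c) ≡ true →
                         NoDup (Colouring.forbidden k c)
    forbidden-distinct k c proper-c =
      noDup-when (loop G v) (zeroColour k) _
        (λ lv → ∉-signedImage⇐ n posNbr negNbr (lookup c) (zeroColour k) λ a →
          (λ p 0≡ca → looped-nonzero a (condC₁ (ι a) (∨-introˡ (posNbr-sym a p)) lv)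
                         (trans (cong (colour k) (sym 0≡ca)) (colour-zeroColour k))) ,
          (λ q 0≡-ca → looped-nonzero a (condC₁ (ι a) (∨-introʳ {pos G (ι a) v} (negNbr-sym a q)) lv)
                         (trans (sym (ℤP.neg-involutive _)) (cong -_ (trans (sym (colour-opposite k _))
                                 (trans (cong (colour k) (sym 0≡-ca)) (colour-zeroColour k)))))))
        (noDup-signedImage n posNbr negNbr (lookup c) separatePos separateMixed separateNeg)
      where
      open Colouring k using (⟦_⟧)
      open Proper (proper⇒Proper (delete G v) k ⟦ c ⟧ proper-c)
      looped-nonzero : ∀ a → loop G (ι a) ≡ true → ⟦ c ⟧ a ≢ ℤ+ 0
      looped-nonzero = loop-ok
      -- condition (a): two positive (or two negative) neighbours are positively adjacent
      separatePos : ∀ a b → a ≢ b → posNbr a ≡ true → posNbr b ≡ true → lookup c a ≢ lookup c b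
      separatePos a b a≢b p q eq =
        pos-ok a b (condA⁺ (ι a) (ι b) (ι-≢ a≢b) (posNbr-sym a p) (posNbr-sym b q)) (cong (colour k) eq)
      separateNeg : ∀ a b → a ≢ b → negNbr a ≡ true → negNbr b ≡ true → lookup c a ≢ lookup c b
      separateNeg a b a≢b p q eq =
        pos-ok a b (condA⁻ (ι a) (ι b) (ι-≢ a≢b) (negNbr-sym a p) (negNbr-sym b q)) (cong (colour k) eq)
      -- condition (b) for distinct neighbours, condition (c) for a vertex adjacent both ways
      separateMixed : ∀ a b → posNbr a ≡ true → negNbr b ≡ true → lookup c a ≢ opposite (lookup c b)
      separateMixed a b p q eq with a FP.≟ b
      ... | yes refl = looped-nonzero a (condC₂ (ι a) (posNbr-sym a p) (negNbr-sym a q))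
                         (self-opposite _ (trans (cong (colour k) eq) (colour-opposite k _)))
      ... | no a≢b   = neg-ok a b (condB (ι a) (ι b) (ι-≢ a≢b) (posNbr-sym a p) (negNbr-sym b q))
                         (trans (cong (colour k) eq) (colour-opposite k _))

    simplicial-elimination : ∀ k →
      ℤ+ (numColourings G k) ≡ ℤ+ (numColourings (delete G v) k) *ℤ eval (linear degree) (ℤ+ (suc (k + k)))
    simplicial-elimination k = Colouring.elimination k (forbidden-distinct k)

record SameAdjacency {n : ℕ} (H D : SGraph n) : Set where
  field
    pos≡  : ∀ a b → pos H a b ≡ pos D a b
    neg≡  : ∀ a b → neg H a b ≡ neg D a b
    loop≡ : ∀ a → loop H a ≡ loop D a

proper-cong : ∀ {n} {H D : SGraph n} → SameAdjacency H D → ∀ k γ → proper H k γ ≡ proper D k γ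
proper-cong {n} same k γ = cong₂ _∧_
  (all-cong (λ u → all-cong (λ u′ → cong₂ _∧_
     (cong (λ b → not b ∨ not (γ u ==ℤ γ u′)) (pos≡ u u′))
     (cong (λ b → not b ∨ not (γ u ==ℤ - γ u′)) (neg≡ u u′))) (allFin n)) (allFin n))
  (all-cong (λ u → cong (λ b → not b ∨ not (γ u ==ℤ ℤ+ 0)) (loop≡ u)) (allFin n))
  where open SameAdjacency same

numColourings-cong : ∀ {n} {H D : SGraph n} → SameAdjacency H D → ∀ k → numColourings H k ≡ numColourings D k
numColourings-cong {n} same k =
  count-cong (λ c → proper-cong same k (λ u → colour k (lookup c u))) (allVecs (suc (k + k)) n)

created-edge-present : ∀ {m} (R : Fin m → Fin m → Bool) → (∀ a b → R a b ≡ R b a) →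
  (w : Fin m) (f : Fin m → Bool) → (∀ u → u ≢ w → f u ≡ true → R u w ≡ true) →
  ∀ x y → (((y == w) ∧ not (x == w) ∧ f x) ∨ ((x == w) ∧ not (y == w) ∧ f y)) ≡ true → R x y ≡ true
created-edge-present R R-sym w f present x y h with ∨-elim {(y == w) ∧ not (x == w) ∧ f x} h
... | inj₁ h₁ = let (y=w , x≠w , fx) = ∧-elim₃ h₁ in
  subst (λ z → R x z ≡ true) (sym (==⇒≡ y w y=w)) (present x (==-false⇒≢ (not-true x≠w)) fx)
... | inj₂ h₂ = let (x=w , y≠w , fy) = ∧-elim₃ h₂ in
  subst (λ z → R z y ≡ true) (sym (==⇒≡ x w x=w))
    (trans (R-sym w y) (present y (==-false⇒≢ (not-true y≠w)) fy))

module Contraction {n : ℕ} (G : SGraph (suc n)) (wf : WellFormed G) (v : Fin (suc n))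
                   (ss : SignedSimplicial G v) where
  open WellFormed wf
  open SignedSimplicial ss

  -- edges u–v that contraction turns into positive u–w edges: condition (a)
  positive-present : ∀ s w → IsEdge G s v w →
    ∀ u → u ≢ w → bySign s (pos G u v) (neg G u v) ≡ true → pos G u w ≡ true
  positive-present plus  w e u u≢w h = condA⁺ u w u≢w h (trans (pos-sym w v) e)
  positive-present minus w e u u≢w h = condA⁻ u w u≢w h (trans (neg-sym w v) e)

  -- edges u–v that contraction turns into negative u–w edges: condition (b)
  negative-present : ∀ s w → IsEdge G s v w →
    ∀ u → u ≢ w → bySign s (neg G u v) (pos G u v) ≡ true → neg G u w ≡ true
  negative-present plus  w e u u≢w h = trans (neg-sym u w) (condB w u (u≢w ∘ sym) (trans (pos-sym w v) e) h)
  negative-present minus w e u u≢w h = condB u w u≢w h (trans (neg-sym w v) e)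

  -- the loop that contraction may put at w: condition (c)
  loop-present : ∀ s w → IsEdge G s v w →
    (loop G v ∨ bySign s (neg G v w) (pos G v w)) ≡ true → loop G w ≡ true
  loop-present plus w e h with ∨-elim {loop G v} h
  ... | inj₁ lv  = condC₁ w (∨-introˡ (trans (pos-sym w v) e)) lv
  ... | inj₂ nvw = condC₂ w (trans (pos-sym w v) e) (trans (neg-sym w v) nvw)
  loop-present minus w e h with ∨-elim {loop G v} h
  ... | inj₁ lv  = condC₁ w (∨-introʳ {pos G w v} (trans (neg-sym w v) e)) lv
  ... | inj₂ pvw = condC₂ w (trans (pos-sym w v) pvw) (trans (neg-sym w v) e)

  contract≈delete : ∀ s w → IsEdge G s v w → SameAdjacency (contract G s v w) (delete G v)
  contract≈delete s w e = record
    { pos≡  = λ a b → bool-ext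
        (λ h → [ id , created-edge-present (pos G) pos-sym w _ (positive-present s w e) (ι a) (ι b) ]′ (∨-elim h))
        ∨-introˡ
    ; neg≡  = λ a b → bool-ext
        (λ h → [ id , created-edge-present (neg G) neg-sym w _ (negative-present s w e) (ι a) (ι b) ]′ (∨-elim h))
        ∨-introˡ
    ; loop≡ = λ a → bool-ext (λ h → [ id , loop-at-w a ]′ (∨-elim h)) ∨-introˡ
    }
    where
    ι : Fin n → Fin (suc n)
    ι = punchIn v
    loop-at-w : ∀ a → ((ι a == w) ∧ (loop G v ∨ bySign s (neg G v w) (pos G v w))) ≡ true → loop G (ι a) ≡ true
    loop-at-w a h = let (a=w , l) = ∧-elim h in
      subst (λ z → loop G z ≡ true) (sym (==⇒≡ (ι a) w a=w)) (loop-present s w e l)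

proposition5p3 : ∀ {n : ℕ} (G : SGraph (suc n)) → WellFormed G →
    (v : Fin (suc n)) → SignedSimplicial G v →
    ∀ (s : Sign) (w : Fin (suc n)) → IsEdge G s v w → Divisional G s v w
proposition5p3 G wf v ss s w e = linear degree , λ k _ → begin
  ℤ+ (numColourings G k)
    ≡⟨ simplicial-elimination k ⟩
  ℤ+ (numColourings (delete G v) k) *ℤ eval (linear degree) (ℤ+ (suc (k + k)))
    ≡⟨ cong (λ N → ℤ+ N *ℤ eval (linear degree) (ℤ+ (suc (k + k)))) (numColourings-cong contracted k) ⟨
  ℤ+ (numColourings (contract G s v w) k) *ℤ eval (linear degree) (ℤ+ (suc (k + k))) ∎
  where
  open ≡-Reasoning
  open Elimination G wf v using (degree; module Simplicial)
  open Simplicial ss using (simplicial-elimination)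
  contracted : SameAdjacency (contract G s v w) (delete G v)
  contracted = Contraction.contract≈delete G wf v ss s w e
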